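{- Let $\mathcal M=(M,\le,{}^\perp)$ be a complete orthomodular lattice, $L$ an involutive submonoid of $\mathbf{Lin}(\mathcal M)$ containing all Sasaki projections, and $\mathscr P(L)$ the corresponding involutive generalized dynamic algebra. Then $\widetilde{\mathscr P(L)}=(\{{\sim}W:W\in\mathscr P(L)\},\preceq,{\sim})$ is a complete orthomodular lattice closed under ${\sim}$, and the map $\delta:M\to\widetilde{\mathscr P(L)}$, $\delta(m)=\{\pi_m\}$, is an order-isomorphism satisfying $\delta(m^\perp)={\sim}\delta(m)$ for all $m\in M$.
   Context: An orthomodular lattice $(M,\le,{}^\perp)$ is a bounded lattice with ${}^\perp$ such that $m\wedge m^\perp=0$, $m\vee m^\perp=1$, $m\le n\Rightarrow n^\perp\le m^\perp$, $m^{\perp\perp}=m$, and $m\le n\Rightarrow n=m\vee(m^\perp\wedge n)$. Sasaki projection: $\pi_m(x)=m\wedge(m^\perp\vee x)$. A map $f:M\to M$ is linear if there is $f^*:M\to M$ (unique) with $f(x)\le y^\perp\iff x\le(f^*(y))^\perp$; $\mathbf{Lin}(\mathcal M)$ is the set of linear maps, an involutive monoid under $\circ$, $f\mapsto f^*$, $\mathrm{id}_M$; each $\pi_m$ is linear, $\pi_m^*=\pi_m$. $\mathscr P(L)$: all subsets of $L$ with join = union, $A\odot B=\{a\circ b:a\in A,b\in B\}$, $A^*=\{a^*:a\in A\}$, ${\sim}A=\{\pi_{(\bigvee_{a\in A}a(1))^\perp}\}$, unit $\{\mathrm{id}_M\}$. On $\widetilde{\mathscr P(L)}=\{{\sim}W:W\in\mathscr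 P(L)\}$: for $\mathcal W\subseteq\widetilde{\mathscr P(L)}$, $\bigvee\mathcal W:={\sim}{\sim}(\bigcup\mathcal W)$, and $X\preceq Y$ iff $\bigvee\{X,Y\}=Y$. -}

module Defs where

open import Level using (Level; _⊔_; 0ℓ; Setω)
open import Data.Bool using (Bool; true; false; if_then_else_)
open import Data.Empty using (⊥; ⊥-elim)
open import Data.Product using (Σ; Σ-syntax; _×_; _,_; proj₁; proj₂)
open import Function using (id; _∘_)
open import Relation.Binary using (Rel; IsPartialOrder)
open import Relation.Binary.PropositionalEquality using (_≡_; _≗_; sym)
open import Relation.Unary using (Pred; _∈_; _⊆_; _∪_; _≐_)

module OMLOps {a ℓ} {A : Set a} (_≤_ : Rel A ℓ)
              (⋁ : ∀ {i} {I : Set i} → (I → A) → A) where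

  _∨_ : A → A → A
  x ∨ y = ⋁ (λ (b : Bool) → if b then x else y)

  ⋀ : ∀ {i} {I : Set i} → (I → A) → A
  ⋀ {I = I} f = ⋁ (λ (p : Σ A (λ x → ∀ (j : I) → x ≤ f j)) → proj₁ p)

  _∧_ : A → A → A
  x ∧ y = ⋀ (λ (b : Bool) → if b then x else y)

  𝟘 : A
  𝟘 = ⋁ {I = ⊥} ⊥-elim

  𝟙 : A
  𝟙 = ⋀ {I = ⊥} ⊥-elim

record IsCompleteOML {a ℓ₁ ℓ₂} {A : Set a} (_≈_ : Rel A ℓ₁) (_≤_ : Rel A ℓ₂)
                     (_ᗮ : A → A) : Setω where
  field
    isPartialOrder : IsPartialOrder _≈_ _≤_
    ᗮ-cong  : ∀ {x y} → x ≈ y → (x ᗮ) ≈ (y ᗮ)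
    ⋁       : ∀ {i} {I : Set i} → (I → A) → A
    ⋁-upper : ∀ {i} {I : Set i} (f : I → A) (j : I) → f j ≤ ⋁ f
    ⋁-least : ∀ {i} {I : Set i} (f : I → A) (x : A) → (∀ j → f j ≤ x) → ⋁ f ≤ x
    compl-meet  : ∀ m → OMLOps._∧_ _≤_ ⋁ m (m ᗮ) ≈ OMLOps.𝟘 _≤_ ⋁
    compl-join  : ∀ m → OMLOps._∨_ _≤_ ⋁ m (m ᗮ) ≈ OMLOps.𝟙 _≤_ ⋁
    antitone    : ∀ {m n} → m ≤ n → (n ᗮ) ≤ (m ᗮ)
    involutive  : ∀ m → ((m ᗮ) ᗮ) ≈ m
    orthomodular : ∀ {m n} → m ≤ n →
                   n ≈ OMLOps._∨_ _≤_ ⋁ m (OMLOps._∧_ _≤_ ⋁ (m ᗮ) n)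

record CompleteOML : Setω where
  field
    Carrier : Set
    _≤_     : Rel Carrier 0ℓ
    _ᗮ      : Carrier → Carrier
    isCompleteOML : IsCompleteOML _≡_ _≤_ _ᗮ
  open IsCompleteOML isCompleteOML public
  open OMLOps _≤_ ⋁ public

module _ (𝓜 : CompleteOML) where
  open CompleteOML 𝓜 renaming (Carrier to M)

  π : M → M → M
  π m x = m ∧ ((m ᗮ) ∨ x)

  IsAdjoint : (M → M) → (M → M) → Set
  IsAdjoint f g = ∀ x y → (f x ≤ (y ᗮ) → x ≤ (g y ᗮ)) × (x ≤ (g y ᗮ) → f x ≤ (y ᗮ))

  Linear : (M → M) → Set
  Linear f = Σ (M → M) (IsAdjoint f)

  record IsInvolutiveSubmonoidWithSasaki (L : Pred (M → M) 0ℓ) : Set where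
    field
      L-ext     : ∀ {f g} → f ≗ g → L f → L g
      L-linear  : ∀ {f} → L f → Linear f
      L-id      : L id
      L-comp    : ∀ {f g} → L f → L g → L (f ∘ g)
      L-star    : ∀ {f g} → L f → IsAdjoint f g → L g
      L-sasaki  : ∀ m → L (π m)

  ~ : ∀ {ℓ} → Pred (M → M) ℓ → Pred (M → M) 0ℓ
  ~ A f = f ≗ π ((⋁ (λ (p : Σ (M → M) (λ a → a ∈ A)) → proj₁ p 𝟙)) ᗮ)

  -- X ≼ Y  iff  ⋁{X,Y} = Y, where ⋁{X,Y} = ~~(X ∪ Y)
  _≼_ : Pred (M → M) 0ℓ → Pred (M → M) 0ℓ → Set
  X ≼ Y = ~ (~ (X ∪ Y)) ≐ Y

  δ : M → Pred (M → M) 0ℓ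
  δ m f = f ≗ π m

  module _ (L : Pred (M → M) 0ℓ) (hL : IsInvolutiveSubmonoidWithSasaki L) where
    open IsInvolutiveSubmonoidWithSasaki hL

    -- X ∈ ~P(L) : X = ~W for some W ∈ P(L) (i.e. W ⊆ L)
    InTildeP : Pred (M → M) 0ℓ → Set₁
    InTildeP X = Σ[ W ∈ Pred (M → M) 0ℓ ] (W ⊆ L × X ≐ ~ W)

    TildeP : Set₁
    TildeP = Σ (Pred (M → M) 0ℓ) InTildeP

    ~ᵀ : TildeP → TildeP
    ~ᵀ (X , W , W⊆L , X⊆~W , ~W⊆X) =
      ~ X , X , (λ {f} fX → L-ext (λ x → sym (X⊆~W fX x)) (L-sasaki _)) ,
      (λ p → p) , (λ p → p)

    _≐ᵀ_ : TildeP → TildeP → Set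
    X ≐ᵀ Y = proj₁ X ≐ proj₁ Y

    _≼ᵀ_ : TildeP → TildeP → Set
    X ≼ᵀ Y = proj₁ X ≼ proj₁ Y

    record Conclusion : Setω where
      field
        tildeP-completeOML : IsCompleteOML _≐ᵀ_ _≼ᵀ_ ~ᵀ
        tildeP-closed-~    : ∀ X → InTildeP X → InTildeP (~ X)
        δ-into             : ∀ m → InTildeP (δ m)
        δ-monotone         : ∀ m n → m ≤ n → δ m ≼ δ n
        δ-reflecting       : ∀ m n → δ m ≼ δ n → m ≤ n
        δ-injective        : ∀ m n → δ m ≐ δ n → m ≡ n
        δ-surjective       : ∀ X → InTildeP X → Σ M (λ m → δ m ≐ X)
        δ-ᗮ                : ∀ m → δ (m ᗮ) ≐ ~ (δ m)

-- Write ⋁A(𝟙) for ⋁_{a∈A} a(𝟙). Since π_m(𝟙) = m, we get ⋁(δ m)(𝟙) = m, and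
-- ~W = δ((⋁W(𝟙))ᗮ) by definition; so every element X of ~P(L) is δ(⋁X(𝟙)), and
-- X ↦ ⋁X(𝟙) is a bijection ~P(L) → M inverse to δ. It turns ~ into ᗮ, and
-- ≼ into ≤ because ~~(X ∪ Y) = δ(⋁X(𝟙) ∨ ⋁Y(𝟙)). Hence the complete
-- orthomodular structure of M transports along δ to ~P(L).
module Submission where

open import Defs
open import Level using (Level; 0ℓ)
open import Data.Bool using (true; false)
open import Data.Bool.Properties using (if-float)
open import Data.Empty using (⊥-elim)
open import Data.Product using (Σ; _,_; proj₁; proj₂)
open import Data.Sum using (inj₁; inj₂)
open import Function using (_∘_)
open import Relation.Binary using (Rel; IsPartialOrder)
open import Relation.Binary.PropositionalEquality
  using (_≡_; refl; sym; trans; cong; module ≡-Reasoning)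
open import Relation.Unary using (Pred; _∈_; _⊆_; _∪_; _≐_)
open import Relation.Unary.Properties using (≐-refl; ≐-sym; ≐-trans)

module CompleteOMLProperties (𝓜 : CompleteOML) where
  open CompleteOML 𝓜 renaming (Carrier to M)
  open IsPartialOrder isPartialOrder public
    using (antisym; reflexive) renaming (refl to ≤-refl; trans to ≤-trans)

  x≤x∨y : ∀ x y → x ≤ (x ∨ y)
  x≤x∨y x y = ⋁-upper _ true

  y≤x∨y : ∀ x y → y ≤ (x ∨ y)
  y≤x∨y x y = ⋁-upper _ false

  ∨-least : ∀ {x y z} → x ≤ z → y ≤ z → (x ∨ y) ≤ z
  ∨-least x≤z y≤z = ⋁-least _ _ λ { true → x≤z ; false → y≤z }

  x∨y≡y⇒x≤y : ∀ {x y} → (x ∨ y) ≡ y → x ≤ y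
  x∨y≡y⇒x≤y {x} {y} eq = ≤-trans (x≤x∨y x y) (reflexive eq)

  x≤y⇒x∨y≡y : ∀ {x y} → x ≤ y → (x ∨ y) ≡ y
  x≤y⇒x∨y≡y {x} {y} x≤y = antisym (∨-least x≤y ≤-refl) (y≤x∨y x y)

  ⋀-lower : ∀ {i} {I : Set i} (f : I → M) j → ⋀ f ≤ f j
  ⋀-lower f j = ⋁-least _ (f j) (λ lb → proj₂ lb j)

  ⋀-greatest : ∀ {i} {I : Set i} (f : I → M) x → (∀ j → x ≤ f j) → x ≤ ⋀ f
  ⋀-greatest f x x≤f = ⋁-upper (λ (lb : Σ M (λ y → ∀ j → y ≤ f j)) → proj₁ lb) (x , x≤f)

  x∧y≤x : ∀ x y → (x ∧ y) ≤ x
  x∧y≤x x y = ⋀-lower _ true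

  ∧-greatest : ∀ {x y z} → z ≤ x → z ≤ y → z ≤ (x ∧ y)
  ∧-greatest z≤x z≤y = ⋀-greatest _ _ λ { true → z≤x ; false → z≤y }

  x≤𝟙 : ∀ x → x ≤ 𝟙
  x≤𝟙 x = ⋀-greatest ⊥-elim x λ ()

  ⋁-cong : ∀ {i} {I : Set i} {f g : I → M} → (∀ j → f j ≡ g j) → ⋁ f ≡ ⋁ g
  ⋁-cong {f = f} {g} f≡g = antisym
    (⋁-least f _ λ j → ≤-trans (reflexive (f≡g j)) (⋁-upper g j))
    (⋁-least g _ λ j → ≤-trans (reflexive (sym (f≡g j))) (⋁-upper f j))

  ⋀-cong : ∀ {i} {I : Set i} {f g : I → M} → (∀ j → f j ≡ g j) → ⋀ f ≡ ⋀ g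
  ⋀-cong {f = f} {g} f≡g = antisym
    (⋀-greatest g _ λ j → ≤-trans (⋀-lower f j) (reflexive (f≡g j)))
    (⋀-greatest f _ λ j → ≤-trans (⋀-lower g j) (reflexive (sym (f≡g j))))

  π-𝟙 : ∀ m → π 𝓜 m 𝟙 ≡ m
  π-𝟙 m = antisym (x∧y≤x _ _) (∧-greatest ≤-refl (≤-trans (x≤𝟙 m) (y≤x∨y _ _)))

module TransportCompleteOML (𝓜 : CompleteOML) {t ℓ₁ ℓ₂} {T : Set t}
  (_≈_ : Rel T ℓ₁) (_≼_ : Rel T ℓ₂) (~ : T → T)
  (e : T → CompleteOML.Carrier 𝓜) (s : CompleteOML.Carrier 𝓜 → T)
  (e∘s : ∀ m → e (s m) ≡ m)
  (≈⇒≡ : ∀ {X Y} → X ≈ Y → e X ≡ e Y)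
  (≡⇒≈ : ∀ {X Y} → e X ≡ e Y → X ≈ Y)
  (≼⇒≤ : ∀ {X Y} → X ≼ Y → CompleteOML._≤_ 𝓜 (e X) (e Y))
  (≤⇒≼ : ∀ {X Y} → CompleteOML._≤_ 𝓜 (e X) (e Y) → X ≼ Y)
  (e-~ : ∀ X → e (~ X) ≡ CompleteOML._ᗮ 𝓜 (e X))
  where
  open CompleteOML 𝓜 renaming (Carrier to M)
  open CompleteOMLProperties 𝓜

  ⋁ᵀ : ∀ {i} {I : Set i} → (I → T) → T
  ⋁ᵀ f = s (⋁ (e ∘ f))

  open OMLOps _≼_ ⋁ᵀ using () renaming (_∨_ to _∨ᵀ_; _∧_ to _∧ᵀ_; ⋀ to ⋀ᵀ; 𝟘 to 𝟘ᵀ; 𝟙 to 𝟙ᵀ)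

  e-⋀ᵀ : ∀ {i} {I : Set i} (f : I → T) → e (⋀ᵀ f) ≡ ⋀ (e ∘ f)
  e-⋀ᵀ f = trans (e∘s _) (antisym
    (⋁-least _ _ λ lb → ⋀-greatest _ _ λ j → ≼⇒≤ (proj₂ lb j))
    (≤-trans (reflexive (sym (e∘s glb))) (⋁-upper (e ∘ proj₁) (s glb , s-glb-lower))))
    where
    glb = ⋀ (e ∘ f)
    s-glb-lower : ∀ j → s glb ≼ f j
    s-glb-lower j = ≤⇒≼ (≤-trans (reflexive (e∘s glb)) (⋀-lower _ j))

  e-∨ᵀ : ∀ X Y → e (X ∨ᵀ Y) ≡ (e X ∨ e Y)
  e-∨ᵀ X Y = trans (e∘s _) (⋁-cong (λ b → if-float e b))

  e-∧ᵀ : ∀ X Y → e (X ∧ᵀ Y) ≡ (e X ∧ e Y)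
  e-∧ᵀ X Y = trans (e-⋀ᵀ _) (⋀-cong (λ b → if-float e b))

  e-𝟘ᵀ : e 𝟘ᵀ ≡ 𝟘
  e-𝟘ᵀ = trans (e∘s _) (⋁-cong {f = e ∘ ⊥-elim} λ ())

  e-𝟙ᵀ : e 𝟙ᵀ ≡ 𝟙
  e-𝟙ᵀ = trans (e-⋀ᵀ ⊥-elim) (⋀-cong {f = e ∘ ⊥-elim} λ ())

  isCompleteOMLᵀ : IsCompleteOML _≈_ _≼_ ~
  isCompleteOMLᵀ = record
    { isPartialOrder = record
      { isPreorder = record
        { isEquivalence = record
          { refl  = ≡⇒≈ refl
          ; sym   = λ X≈Y → ≡⇒≈ (sym (≈⇒≡ X≈Y))
          ; trans = λ X≈Y Y≈Z → ≡⇒≈ (trans (≈⇒≡ X≈Y) (≈⇒≡ Y≈Z))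
          }
        ; reflexive = λ X≈Y → ≤⇒≼ (reflexive (≈⇒≡ X≈Y))
        ; trans     = λ X≼Y Y≼Z → ≤⇒≼ (≤-trans (≼⇒≤ X≼Y) (≼⇒≤ Y≼Z))
        }
      ; antisym = λ X≼Y Y≼X → ≡⇒≈ (antisym (≼⇒≤ X≼Y) (≼⇒≤ Y≼X))
      }
    ; ᗮ-cong  = λ {X} {Y} X≈Y → ≡⇒≈ (begin
        e (~ X)  ≡⟨ e-~ X ⟩
        e X ᗮ    ≡⟨ cong _ᗮ (≈⇒≡ X≈Y) ⟩
        e Y ᗮ    ≡⟨ sym (e-~ Y) ⟩
        e (~ Y)  ∎)
    ; ⋁       = ⋁ᵀ
    ; ⋁-upper = λ f j → ≤⇒≼ (≤-trans (⋁-upper (e ∘ f) j) (reflexive (sym (e∘s _))))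
    ; ⋁-least = λ f X f≼X → ≤⇒≼ (≤-trans (reflexive (e∘s _)) (⋁-least _ _ (≼⇒≤ ∘ f≼X)))
    ; compl-meet = λ X → ≡⇒≈ (begin
        e (X ∧ᵀ ~ X)     ≡⟨ e-∧ᵀ X (~ X) ⟩
        e X ∧ e (~ X)    ≡⟨ cong (e X ∧_) (e-~ X) ⟩
        e X ∧ (e X ᗮ)    ≡⟨ compl-meet (e X) ⟩
        𝟘                ≡⟨ sym e-𝟘ᵀ ⟩
        e 𝟘ᵀ             ∎)
    ; compl-join = λ X → ≡⇒≈ (begin
        e (X ∨ᵀ ~ X)     ≡⟨ e-∨ᵀ X (~ X) ⟩
        e X ∨ e (~ X)    ≡⟨ cong (e X ∨_) (e-~ X) ⟩
        e X ∨ (e X ᗮ)    ≡⟨ compl-join (e X) ⟩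
        𝟙                ≡⟨ sym e-𝟙ᵀ ⟩
        e 𝟙ᵀ             ∎)
    ; antitone = λ {X} {Y} X≼Y → ≤⇒≼
        (≤-trans (reflexive (e-~ Y)) (≤-trans (antitone (≼⇒≤ X≼Y)) (reflexive (sym (e-~ X)))))
    ; involutive = λ X → ≡⇒≈ (begin
        e (~ (~ X))      ≡⟨ e-~ (~ X) ⟩
        e (~ X) ᗮ        ≡⟨ cong _ᗮ (e-~ X) ⟩
        (e X ᗮ) ᗮ        ≡⟨ involutive (e X) ⟩
        e X              ∎)
    ; orthomodular = λ {X} {Y} X≼Y → ≡⇒≈ (begin
        e Y                          ≡⟨ orthomodular (≼⇒≤ X≼Y) ⟩
        e X ∨ ((e X ᗮ) ∧ e Y)        ≡⟨ cong (λ z → e X ∨ (z ∧ e Y)) (sym (e-~ X)) ⟩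
        e X ∨ (e (~ X) ∧ e Y)        ≡⟨ cong (e X ∨_) (sym (e-∧ᵀ (~ X) Y)) ⟩
        e X ∨ e (~ X ∧ᵀ Y)           ≡⟨ sym (e-∨ᵀ X (~ X ∧ᵀ Y)) ⟩
        e (X ∨ᵀ (~ X ∧ᵀ Y))          ∎)
    }
    where open ≡-Reasoning

module SasakiSingletons (𝓜 : CompleteOML) where
  open CompleteOML 𝓜 renaming (Carrier to M)
  open CompleteOMLProperties 𝓜

  private variable ℓ ℓ′ : Level

  -- Chosen so that  ~ A  is definitionally  δ ((⋁𝟙 A) ᗮ).
  ⋁𝟙 : Pred (M → M) ℓ → M
  ⋁𝟙 A = ⋁ (λ (a : Σ (M → M) (λ a → a ∈ A)) → proj₁ a 𝟙)

  ⋁𝟙-upper : (A : Pred (M → M) ℓ) {a : M → M} → a ∈ A → a 𝟙 ≤ ⋁𝟙 A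
  ⋁𝟙-upper A {a} a∈A = ⋁-upper (λ (a : Σ (M → M) (λ a → a ∈ A)) → proj₁ a 𝟙) (a , a∈A)

  ⋁𝟙-least : (A : Pred (M → M) ℓ) (x : M) → (∀ {a} → a ∈ A → a 𝟙 ≤ x) → ⋁𝟙 A ≤ x
  ⋁𝟙-least A x bound = ⋁-least _ x (bound ∘ proj₂)

  ⋁𝟙-mono : (A : Pred (M → M) ℓ) (B : Pred (M → M) ℓ′) → A ⊆ B → ⋁𝟙 A ≤ ⋁𝟙 B
  ⋁𝟙-mono A B A⊆B = ⋁𝟙-least A _ (⋁𝟙-upper B ∘ A⊆B)

  ⋁𝟙-cong : (A : Pred (M → M) ℓ) (B : Pred (M → M) ℓ′) → A ≐ B → ⋁𝟙 A ≡ ⋁𝟙 B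
  ⋁𝟙-cong A B (A⊆B , B⊆A) = antisym (⋁𝟙-mono A B A⊆B) (⋁𝟙-mono B A B⊆A)

  ⋁𝟙-δ : ∀ m → ⋁𝟙 (δ 𝓜 m) ≡ m
  ⋁𝟙-δ m = antisym
    (⋁𝟙-least (δ 𝓜 m) m λ a≗πm → reflexive (trans (a≗πm 𝟙) (π-𝟙 m)))
    (≤-trans (reflexive (sym (π-𝟙 m))) (⋁𝟙-upper (δ 𝓜 m) (λ _ → refl)))

  ⋁𝟙-∪ : (A : Pred (M → M) ℓ) (B : Pred (M → M) ℓ′) → ⋁𝟙 (A ∪ B) ≡ (⋁𝟙 A ∨ ⋁𝟙 B)
  ⋁𝟙-∪ A B = antisym
    (⋁𝟙-least (A ∪ B) _ λ
      { (inj₁ a∈A) → ≤-trans (⋁𝟙-upper A a∈A) (x≤x∨y _ _)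
      ; (inj₂ a∈B) → ≤-trans (⋁𝟙-upper B a∈B) (y≤x∨y _ _) })
    (∨-least (⋁𝟙-mono A (A ∪ B) inj₁) (⋁𝟙-mono B (A ∪ B) inj₂))

  δ-cong : ∀ {m n} → m ≡ n → δ 𝓜 m ≐ δ 𝓜 n
  δ-cong refl = ≐-refl

  δ-injective : ∀ {m n} → δ 𝓜 m ≐ δ 𝓜 n → m ≡ n
  δ-injective {m} {n} δm≐δn =
    trans (sym (⋁𝟙-δ m)) (trans (⋁𝟙-cong (δ 𝓜 m) (δ 𝓜 n) δm≐δn) (⋁𝟙-δ n))

  ~~-δ : (A : Pred (M → M) ℓ) → ~ 𝓜 (~ 𝓜 A) ≐ δ 𝓜 (⋁𝟙 A)
  ~~-δ A = δ-cong (trans (cong _ᗮ (⋁𝟙-δ (⋁𝟙 A ᗮ))) (involutive (⋁𝟙 A)))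

  IsSasakiSingleton : Pred (M → M) 0ℓ → Set
  IsSasakiSingleton X = X ≐ δ 𝓜 (⋁𝟙 X)

  δ-isSasakiSingleton : ∀ m → IsSasakiSingleton (δ 𝓜 m)
  δ-isSasakiSingleton m = δ-cong (sym (⋁𝟙-δ m))

  ≐δ⇒isSasakiSingleton : ∀ {X m} → X ≐ δ 𝓜 m → IsSasakiSingleton X
  ≐δ⇒isSasakiSingleton {X} {m} X≐δm =
    ≐-trans X≐δm (δ-cong (sym (trans (⋁𝟙-cong X (δ 𝓜 m) X≐δm) (⋁𝟙-δ m))))

  ~~∪-δ : (X Y : Pred (M → M) 0ℓ) → ~ 𝓜 (~ 𝓜 (X ∪ Y)) ≐ δ 𝓜 (⋁𝟙 X ∨ ⋁𝟙 Y)
  ~~∪-δ X Y = ≐-trans (~~-δ (X ∪ Y)) (δ-cong (⋁𝟙-∪ X Y))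

  ≼⇒≤ : ∀ {X Y} → IsSasakiSingleton Y → _≼_ 𝓜 X Y → ⋁𝟙 X ≤ ⋁𝟙 Y
  ≼⇒≤ {X} {Y} Y-sing X≼Y =
    x∨y≡y⇒x≤y (δ-injective (≐-trans (≐-sym (~~∪-δ X Y)) (≐-trans X≼Y Y-sing)))

  ≤⇒≼ : ∀ {X Y} → IsSasakiSingleton Y → ⋁𝟙 X ≤ ⋁𝟙 Y → _≼_ 𝓜 X Y
  ≤⇒≼ {X} {Y} Y-sing X≤Y =
    ≐-trans (~~∪-δ X Y) (≐-trans (δ-cong (x≤y⇒x∨y≡y X≤Y)) (≐-sym Y-sing))

module TildeAlgebra (𝓜 : CompleteOML)
  (L : Pred (CompleteOML.Carrier 𝓜 → CompleteOML.Carrier 𝓜) 0ℓ)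
  (hL : IsInvolutiveSubmonoidWithSasaki 𝓜 L) where
  open CompleteOML 𝓜 renaming (Carrier to M)
  open IsInvolutiveSubmonoidWithSasaki hL
  open CompleteOMLProperties 𝓜 using (≤-trans; reflexive)
  open SasakiSingletons 𝓜

  δ⊆L : ∀ m → δ 𝓜 m ⊆ L
  δ⊆L m f≗πm = L-ext (λ x → sym (f≗πm x)) (L-sasaki m)

  δ∈TildeP : ∀ m → InTildeP 𝓜 L hL (δ 𝓜 m)
  δ∈TildeP m = δ 𝓜 (m ᗮ) , δ⊆L (m ᗮ) ,
    δ-cong (sym (trans (cong _ᗮ (⋁𝟙-δ (m ᗮ))) (involutive m)))

  ~∈TildeP : ∀ X → InTildeP 𝓜 L hL X → InTildeP 𝓜 L hL (~ 𝓜 X)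
  ~∈TildeP X (_ , _ , X⊆~W , _) = X , δ⊆L _ ∘ X⊆~W , ≐-refl

  δ-ᗮ : ∀ m → δ 𝓜 (m ᗮ) ≐ ~ 𝓜 (δ 𝓜 m)
  δ-ᗮ m = δ-cong (cong _ᗮ (sym (⋁𝟙-δ m)))

  T : Set₁
  T = TildeP 𝓜 L hL

  ⋁𝟙ᵀ : T → M
  ⋁𝟙ᵀ = ⋁𝟙 ∘ proj₁

  δᵀ : M → T
  δᵀ m = δ 𝓜 m , δ∈TildeP m

  isSasakiSingletonᵀ : (X : T) → IsSasakiSingleton (proj₁ X)
  isSasakiSingletonᵀ (_ , _ , _ , X≐~W) = ≐δ⇒isSasakiSingleton X≐~W

  ≡⇒≐ᵀ : ∀ {X Y : T} → ⋁𝟙ᵀ X ≡ ⋁𝟙ᵀ Y → _≐ᵀ_ 𝓜 L hL X Y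
  ≡⇒≐ᵀ {X} {Y} eq =
    ≐-trans (isSasakiSingletonᵀ X) (≐-trans (δ-cong eq) (≐-sym (isSasakiSingletonᵀ Y)))

  open TransportCompleteOML 𝓜 (_≐ᵀ_ 𝓜 L hL) (_≼ᵀ_ 𝓜 L hL) (~ᵀ 𝓜 L hL) ⋁𝟙ᵀ δᵀ
    ⋁𝟙-δ
    (λ {X} {Y} → ⋁𝟙-cong (proj₁ X) (proj₁ Y))
    (λ {X} {Y} → ≡⇒≐ᵀ {X} {Y})
    (λ {X} {Y} → ≼⇒≤ (isSasakiSingletonᵀ Y))
    (λ {X} {Y} → ≤⇒≼ (isSasakiSingletonᵀ Y))
    (λ X → ⋁𝟙-δ _)
    public using (isCompleteOMLᵀ)

  δ-monotone : ∀ m n → m ≤ n → _≼_ 𝓜 (δ 𝓜 m) (δ 𝓜 n)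
  δ-monotone m n m≤n = ≤⇒≼ (δ-isSasakiSingleton n)
    (≤-trans (reflexive (⋁𝟙-δ m)) (≤-trans m≤n (reflexive (sym (⋁𝟙-δ n)))))

  δ-reflecting : ∀ m n → _≼_ 𝓜 (δ 𝓜 m) (δ 𝓜 n) → m ≤ n
  δ-reflecting m n δm≼δn = ≤-trans (reflexive (sym (⋁𝟙-δ m)))
    (≤-trans (≼⇒≤ (δ-isSasakiSingleton n) δm≼δn) (reflexive (⋁𝟙-δ n)))

proposition3p10 : (𝓜 : CompleteOML)
    (L : Pred (CompleteOML.Carrier 𝓜 → CompleteOML.Carrier 𝓜) 0ℓ)
    (hL : IsInvolutiveSubmonoidWithSasaki 𝓜 L) →
    Conclusion 𝓜 L hL
proposition3p10 𝓜 L hL = record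
  { tildeP-completeOML = isCompleteOMLᵀ
  ; tildeP-closed-~    = ~∈TildeP
  ; δ-into             = δ∈TildeP
  ; δ-monotone         = δ-monotone
  ; δ-reflecting       = δ-reflecting
  ; δ-injective        = λ _ _ → δ-injective
  ; δ-surjective       = λ X X∈ → ⋁𝟙 X , ≐-sym (isSasakiSingletonᵀ (X , X∈))
  ; δ-ᗮ                = δ-ᗮ
  }
  where
  open TildeAlgebra 𝓜 L hL
  open SasakiSingletons 𝓜 using (δ-injective; ⋁𝟙)
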